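{- An ordered tree $G^<$ is a monotone caterpillar graph if and only if $G^<$ does not contain, as an ordered subgraph, any ordered tree on four vertices that is not a monotone caterpillar graph.
   Context: An ordered graph on $N$ vertices is a graph with vertex set $[N]=\{1,\dots,N\}$ ordered by the usual order of integers; an ordered tree is an ordered graph whose underlying graph is a tree. An ordered graph $G^<$ on $[n]$ is an ordered subgraph of an ordered graph $H^<$ on $[N]$ if there is a map $\phi:[n]\to[N]$ with $\phi(i)<\phi(j)$ whenever $i<j$ such that $\{\phi(i),\phi(j)\}$ is an edge of $H^<$ whenever $\{i,j\}$ is an edge of $G^<$. The ordered star $S^<_{l,r}$ is the ordered graph on $l+r-1$ vertices in which the $l$-th vertex is adjacent to all other vertices and there are no other edges. The join $G^<+H^<$ of ordered graphs $G^<$ (on $m$ vertices) and $H^<$ (on $n$ vertices) is the ordered graph on $m+n-1$ vertices obtained by identifying the leftmost vertex of $H^<$ with the rightmost vertex of $G^<$, with $G^<$ on the left. An ordered graph is a monotone caterpillar graph if it equals $S^<_{l_1,r_1}+\dots+S^<_{l_k,r_k}$ for some positive integers $k,l_1,\dots,l_k,r_1,\dots,r_k$ with $l_i=1$ or $r_i=1$ for each $i$. -}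

module Defs where

open import Data.Nat using (ℕ; zero; suc; _+_; _∸_; _≤_; _<_)
open import Data.Nat.Properties using (<-irrefl)
open import Data.Product using (Σ; _×_; _,_; proj₁; proj₂)
open import Data.Sum using (_⊎_; inj₁; inj₂)
open import Data.List using (List; []; _∷_)
open import Data.List.Relation.Unary.All using (All)
open import Data.Empty using (⊥)
open import Relation.Nullary using (¬_)
open import Relation.Binary.PropositionalEquality using (_≡_; _≢_; refl; sym; trans)

-- An ordered graph on [size]; vertex i (1-based) is represented by the
-- natural number i ∸ 1, i.e. vertices are 0 , … , size ∸ 1 in their usual order.
record OGraph : Set₁ where
  field
    size    : ℕ
    E       : ℕ → ℕ → Set
    E-sym   : ∀ {i j} → E i j → E j i
    E-irr   : ∀ {i} → ¬ E i i
    E-bound : ∀ {i j} → E i j → i < size × j < size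
open OGraph public

_≅_ : OGraph → OGraph → Set
G ≅ H = size G ≡ size H × (∀ i j → (E G i j → E H i j) × (E H i j → E G i j))

_⊑_ : OGraph → OGraph → Set
G ⊑ H = Σ (ℕ → ℕ) λ φ →
  (∀ i → i < size G → φ i < size H) ×
  (∀ i j → i < j → j < size G → φ i < φ j) ×
  (∀ i j → E G i j → E H (φ i) (φ j))

data Reach (G : OGraph) : ℕ → ℕ → Set where
  here : ∀ {i} → Reach G i i
  step : ∀ {i k j} → E G i k → Reach G k j → Reach G i j

Connected : OGraph → Set
Connected G = 1 ≤ size G × (∀ i j → i < size G → j < size G → Reach G i j)

HasCycle : OGraph → Set
HasCycle G = Σ ℕ λ k → Σ (ℕ → ℕ) λ v →
  3 ≤ k ×
  (∀ a → a < k → v a < size G) ×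
  (∀ a b → a < k → b < k → v a ≡ v b → a ≡ b) ×
  (∀ a → suc a < k → E G (v a) (v (suc a))) ×
  E G (v (k ∸ 1)) (v 0)

IsTree : OGraph → Set
IsTree G = Connected G × ¬ HasCycle G

private
  starE : ℕ → ℕ → ℕ → ℕ → Set
  starE s c i j = i < s × j < s × ((i ≡ c × j ≢ c) ⊎ (j ≡ c × i ≢ c))

  swapS : ∀ {A B C D : Set} → (A × B) ⊎ (C × D) → (C × D) ⊎ (A × B)
  swapS (inj₁ x) = inj₂ x
  swapS (inj₂ y) = inj₁ y

star : ℕ → ℕ → OGraph
star l r = record
  { size = s
  ; E = starE s c
  ; E-sym = λ { (p , q , x) → q , p , swapS x }
  ; E-irr = λ { (_ , _ , inj₁ (e , ne)) → ne e ; (_ , _ , inj₂ (e , ne)) → ne e }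
  ; E-bound = λ { (p , q , _) → p , q }
  }
  where
  s = l + r ∸ 1
  c = l ∸ 1

-- Join G + H: identify leftmost vertex of H with rightmost vertex of G.
infixr 6 _⊕_
_⊕_ : OGraph → OGraph → OGraph
G ⊕ H = record
  { size = s
  ; E = JE
  ; E-sym = λ { (p , q , inj₁ e) → q , p , inj₁ (E-sym G e)
              ; (p , q , inj₂ (a , b , e)) → q , p , inj₂ (b , a , E-sym H e) }
  ; E-irr = λ { (_ , _ , inj₁ e) → E-irr G e ; (_ , _ , inj₂ (_ , _ , e)) → E-irr H e }
  ; E-bound = λ { (p , q , _) → p , q }
  }
  where
  s = size G + size H ∸ 1
  o = size G ∸ 1
  JE : ℕ → ℕ → Set
  JE i j = i < s × j < s × (E G i j ⊎ (o ≤ i × o ≤ j × E H (i ∸ o) (j ∸ o)))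

chain : ℕ × ℕ → List (ℕ × ℕ) → OGraph
chain (l , r) [] = star l r
chain (l , r) (q ∷ qs) = star l r ⊕ chain q qs

Admissible : ℕ × ℕ → Set
Admissible (l , r) = 1 ≤ l × 1 ≤ r × (l ≡ 1 ⊎ r ≡ 1)

IsMonotoneCaterpillar : OGraph → Set
IsMonotoneCaterpillar G = Σ (ℕ × ℕ) λ p → Σ (List (ℕ × ℕ)) λ ps →
  Admissible p × All Admissible ps × (G ≅ chain p ps)

-- Call an ordered graph untangled if no two disjoint edges cross or nest and there is no
-- zigzag, i.e. no path b–a–d–c on vertices a < b < c < d.  Stars are untangled and joins
-- preserve this, so monotone caterpillars are untangled.  Conversely, cut an untangled
-- tree at the first inner vertex c over which no edge passes: left of c every inner vertex
-- lies under the edge joining the two ends, which forces that part to be a star centred at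
-- one end, and right of c we recurse.  Both defects are visible on four vertices.  A zigzag
-- is a four-vertex path; for two entangled edges, induct on the length of a walk joining
-- them: the first and last steps of a shortest such walk stay apart from the far edge, so
-- the walk has to jump over an endpoint of it, producing an entangled pair joined by a
-- shorter walk, down to a four-vertex path whose end edges are entangled.  The ordered
-- tree induced on such a path is not a monotone caterpillar.

module Submission where

open import Defs
open import Data.Empty using (⊥; ⊥-elim)
open import Data.List using (List; []; _∷_; length)
open import Data.List.Membership.Propositional using (_∈_; _∉_)
open import Data.List.Relation.Binary.Permutation.Propositional using (↭-sym; ↭⇒↭ₛ)
open import Data.List.Relation.Binary.Permutation.Propositional.Properties using (∈-resp-↭; ↭-length)
import Data.List.Relation.Binary.Permutation.Setoid.Properties as Permutationₛ
import Data.List.Relation.Unary.All as All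
open import Data.List.Relation.Unary.All using ([]; _∷_)
open import Data.List.Relation.Unary.AllPairs as AllPairs using (AllPairs; []; _∷_)
open import Data.List.Relation.Unary.Any using (here; there)
open import Data.List.Relation.Unary.Linked.Properties using (Linked⇒AllPairs)
open import Data.List.Relation.Unary.Unique.Propositional using (Unique)
open import Data.Nat using (ℕ; zero; suc; _+_; _∸_; _≤_; _<_; z≤n; s≤s; _⊓_)
open import Data.Nat.Induction using (<-rec)
open import Data.Nat.Properties
open import Data.List.Sort ≤-decTotalOrder using (sort; sort-↭; sort-↗)
open import Data.List.Membership.DecPropositional _≟_ using (_∈?_)
open import Data.Product using (Σ; ∃; _×_; _,_; proj₁; proj₂)
open import Data.Sum using (_⊎_; inj₁; inj₂)
open import Data.Unit using (⊤; tt)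
open import Function using (_∘_)
open import Relation.Binary using (tri<; tri≈; tri>)
open import Relation.Binary.PropositionalEquality using (_≡_; _≢_; ≢-sym; refl; sym; trans; cong; cong₂; subst; subst₂; setoid)
open import Relation.Nullary using (¬_; Dec; yes; no)
open import Relation.Nullary.Decidable using (_×-dec_; _⊎-dec_; ¬?)
open import Relation.Unary using (Decidable)

-- Relative position of edges

Between : ℕ → ℕ → ℕ → Set
Between z x y = (x < z × z < y) ⊎ (y < z × z < x)

Disjoint : ℕ → ℕ → ℕ → ℕ → Set
Disjoint x y p q = x ≢ p × x ≢ q × y ≢ p × y ≢ q

-- Neither of the segments xy and pq lies to the left of the other.
Overlapping : ℕ → ℕ → ℕ → ℕ → Set
Overlapping x y p q = Between p x y ⊎ Between q x y ⊎ Between x p q ⊎ Between y p q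

Entangled : ℕ → ℕ → ℕ → ℕ → Set
Entangled x y p q = Disjoint x y p q × Overlapping x y p q

Between-sym : ∀ {z x y} → Between z x y → Between z y x
Between-sym (inj₁ b) = inj₂ b
Between-sym (inj₂ b) = inj₁ b

Between-irrefl : ∀ {z x} → ¬ Between z x x
Between-irrefl (inj₁ (x<z , z<x)) = <-asym x<z z<x
Between-irrefl (inj₂ (x<z , z<x)) = <-asym x<z z<x

Between? : ∀ z x y → Dec (Between z x y)
Between? z x y = ((x <? z) ×-dec (z <? y)) ⊎-dec ((y <? z) ×-dec (z <? x))

Between⇒≢ˡ : ∀ {z x y} → Between z x y → z ≢ x
Between⇒≢ˡ (inj₁ (x<z , _)) z≡x = <⇒≢ x<z (sym z≡x)
Between⇒≢ˡ (inj₂ (_ , z<x)) z≡x = <⇒≢ z<x z≡x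

Between⇒≢ʳ : ∀ {z x y} → Between z x y → z ≢ y
Between⇒≢ʳ b = Between⇒≢ˡ (Between-sym b)

Between-move : ∀ {z a b c} → Between z a c → ¬ Between z a b → b ≢ z → Between z b c
Between-move {z} {a} {b} (inj₁ (a<z , z<c)) ¬zab b≢z with <-cmp b z
... | tri< b<z _ _ = inj₁ (b<z , z<c)
... | tri≈ _ b≡z _ = ⊥-elim (b≢z b≡z)
... | tri> _ _ z<b = ⊥-elim (¬zab (inj₁ (a<z , z<b)))
Between-move {z} {a} {b} (inj₂ (c<z , z<a)) ¬zab b≢z with <-cmp b z
... | tri< b<z _ _ = ⊥-elim (¬zab (inj₂ (b<z , z<a)))
... | tri≈ _ b≡z _ = ⊥-elim (b≢z b≡z)
... | tri> _ _ z<b = inj₂ (c<z , z<b)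

Entangled-swapˡ : ∀ {x y p q} → Entangled x y p q → Entangled y x p q
Entangled-swapˡ ((x≢p , x≢q , y≢p , y≢q) , ov) = (y≢p , y≢q , x≢p , x≢q) , swap ov
  where
  swap : ∀ {x y p q} → Overlapping x y p q → Overlapping y x p q
  swap (inj₁ b) = inj₁ (Between-sym b)
  swap (inj₂ (inj₁ b)) = inj₂ (inj₁ (Between-sym b))
  swap (inj₂ (inj₂ (inj₁ b))) = inj₂ (inj₂ (inj₂ b))
  swap (inj₂ (inj₂ (inj₂ b))) = inj₂ (inj₂ (inj₁ b))

Entangled-comm : ∀ {x y p q} → Entangled x y p q → Entangled p q x y
Entangled-comm ((x≢p , x≢q , y≢p , y≢q) , ov) =
  (≢-sym x≢p , ≢-sym y≢p , ≢-sym x≢q , ≢-sym y≢q) , swap ov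
  where
  swap : ∀ {x y p q} → Overlapping x y p q → Overlapping p q x y
  swap (inj₁ b) = inj₂ (inj₂ (inj₁ b))
  swap (inj₂ (inj₁ b)) = inj₂ (inj₂ (inj₂ b))
  swap (inj₂ (inj₂ (inj₁ b))) = inj₁ b
  swap (inj₂ (inj₂ (inj₂ b))) = inj₂ (inj₁ b)

Entangled-swapʳ : ∀ {x y p q} → Entangled x y p q → Entangled x y q p
Entangled-swapʳ e = Entangled-comm (Entangled-swapˡ (Entangled-comm e))

module StrictlyMonotoneOn (S : ℕ → Set) (f : ℕ → ℕ)
  (mono : ∀ {a b} → S a → S b → a < b → f a < f b) where

  reflects-< : ∀ {a b} → S a → S b → f a < f b → a < b
  reflects-< {a} {b} sa sb fa<fb with <-cmp a b
  ... | tri< a<b _ _ = a<b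
  ... | tri≈ _ refl _ = ⊥-elim (<-irrefl refl fa<fb)
  ... | tri> _ _ b<a = ⊥-elim (<-asym fa<fb (mono sb sa b<a))

  injective : ∀ {a b} → S a → S b → f a ≡ f b → a ≡ b
  injective {a} {b} sa sb fa≡fb with <-cmp a b
  ... | tri< a<b _ _ = ⊥-elim (<⇒≢ (mono sa sb a<b) fa≡fb)
  ... | tri≈ _ a≡b _ = a≡b
  ... | tri> _ _ b<a = ⊥-elim (<⇒≢ (mono sb sa b<a) (sym fa≡fb))

  preserves-Between : ∀ {z x y} → S z → S x → S y → Between z x y → Between (f z) (f x) (f y)
  preserves-Between sz sx sy (inj₁ (x<z , z<y)) = inj₁ (mono sx sz x<z , mono sz sy z<y)
  preserves-Between sz sx sy (inj₂ (y<z , z<x)) = inj₂ (mono sy sz y<z , mono sz sx z<x)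

  reflects-Between : ∀ {z x y} → S z → S x → S y → Between (f z) (f x) (f y) → Between z x y
  reflects-Between sz sx sy (inj₁ (x<z , z<y)) = inj₁ (reflects-< sx sz x<z , reflects-< sz sy z<y)
  reflects-Between sz sx sy (inj₂ (y<z , z<x)) = inj₂ (reflects-< sy sz y<z , reflects-< sz sx z<x)

  preserves-Entangled : ∀ {x y p q} → S x → S y → S p → S q →
    Entangled x y p q → Entangled (f x) (f y) (f p) (f q)
  preserves-Entangled {x} {y} {p} {q} sx sy sp sq ((x≢p , x≢q , y≢p , y≢q) , ov) =
    (≢ sx sp x≢p , ≢ sx sq x≢q , ≢ sy sp y≢p , ≢ sy sq y≢q) , map ov
    where
    ≢ : ∀ {a b} → S a → S b → a ≢ b → f a ≢ f b
    ≢ sa sb a≢b fa≡fb = a≢b (injective sa sb fa≡fb)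
    map : Overlapping x y p q → Overlapping (f x) (f y) (f p) (f q)
    map (inj₁ b) = inj₁ (preserves-Between sp sx sy b)
    map (inj₂ (inj₁ b)) = inj₂ (inj₁ (preserves-Between sq sx sy b))
    map (inj₂ (inj₂ (inj₁ b))) = inj₂ (inj₂ (inj₁ (preserves-Between sx sp sq b)))
    map (inj₂ (inj₂ (inj₂ b))) = inj₂ (inj₂ (inj₂ (preserves-Between sy sp sq b)))

  reflects-Entangled : ∀ {x y p q} → S x → S y → S p → S q →
    Entangled (f x) (f y) (f p) (f q) → Entangled x y p q
  reflects-Entangled {x} {y} {p} {q} sx sy sp sq ((x≢p , x≢q , y≢p , y≢q) , ov) =
    (≢ x≢p , ≢ x≢q , ≢ y≢p , ≢ y≢q) , map ov
    where
    ≢ : ∀ {a b} → f a ≢ f b → a ≢ b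
    ≢ fa≢fb a≡b = fa≢fb (cong f a≡b)
    map : Overlapping (f x) (f y) (f p) (f q) → Overlapping x y p q
    map (inj₁ b) = inj₁ (reflects-Between sp sx sy b)
    map (inj₂ (inj₁ b)) = inj₂ (inj₁ (reflects-Between sq sx sy b))
    map (inj₂ (inj₂ (inj₁ b))) = inj₂ (inj₂ (inj₁ (reflects-Between sx sp sq b)))
    map (inj₂ (inj₂ (inj₂ b))) = inj₂ (inj₂ (inj₂ (reflects-Between sy sp sq b)))

-- Untangled ordered graphs and monotone caterpillars

record Untangled (G : OGraph) : Set where
  field
    unentangled : ∀ {x y p q} → E G x y → E G p q → ¬ Entangled x y p q
    no-zigzag   : ∀ {a b c d} → a < b → b < c → c < d → E G a b → E G a d → E G c d → ⊥

Untangled-⊑ : ∀ {T G} → T ⊑ G → Untangled G → Untangled T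
Untangled-⊑ {T} {G} (φ , φ-bound , φ-mono , φ-edge) untangled = record
  { unentangled = λ {x} {y} {p} {q} exy epq entangled →
      Untangled.unentangled untangled (φ-edge x y exy) (φ-edge p q epq)
        (preserves-Entangled (proj₁ (E-bound T exy)) (proj₂ (E-bound T exy))
                             (proj₁ (E-bound T epq)) (proj₂ (E-bound T epq)) entangled)
  ; no-zigzag = λ {a} {b} {c} {d} a<b b<c c<d eab ead ecd →
      Untangled.no-zigzag untangled (φ-mono a b a<b (proj₂ (E-bound T eab)))
        (φ-mono b c b<c (proj₁ (E-bound T ecd))) (φ-mono c d c<d (proj₂ (E-bound T ecd)))
        (φ-edge a b eab) (φ-edge a d ead) (φ-edge c d ecd)
  }
  where
  open StrictlyMonotoneOn (_< size T) φ (λ {a} {b} _ b<n a<b → φ-mono a b a<b b<n)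

≅⇒⊑ : ∀ {G H} → G ≅ H → G ⊑ H
≅⇒⊑ (size≡ , edges) =
  (λ i → i) , (λ i i<n → subst (i <_) size≡ i<n) , (λ i j i<j _ → i<j) , λ i j → proj₁ (edges i j)

star-edge-centre : ∀ {l r i j} → E (star l r) i j → i ≡ l ∸ 1 ⊎ j ≡ l ∸ 1
star-edge-centre (_ , _ , inj₁ (i≡c , _)) = inj₁ i≡c
star-edge-centre (_ , _ , inj₂ (j≡c , _)) = inj₂ j≡c

star-untangled : ∀ l r → Untangled (star l r)
star-untangled l r = record { unentangled = unentangled′ ; no-zigzag = no-zigzag′ }
  where
  unentangled′ : ∀ {x y p q} → E (star l r) x y → E (star l r) p q → ¬ Entangled x y p q
  unentangled′ exy epq ((x≢p , x≢q , y≢p , y≢q) , _)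
    with star-edge-centre {l} {r} exy | star-edge-centre {l} {r} epq
  ... | inj₁ x≡c | inj₁ p≡c = x≢p (trans x≡c (sym p≡c))
  ... | inj₁ x≡c | inj₂ q≡c = x≢q (trans x≡c (sym q≡c))
  ... | inj₂ y≡c | inj₁ p≡c = y≢p (trans y≡c (sym p≡c))
  ... | inj₂ y≡c | inj₂ q≡c = y≢q (trans y≡c (sym q≡c))
  no-zigzag′ : ∀ {a b c d} → a < b → b < c → c < d →
    E (star l r) a b → E (star l r) a d → E (star l r) c d → ⊥
  no-zigzag′ a<b b<c c<d eab _ ecd with star-edge-centre {l} {r} eab | star-edge-centre {l} {r} ecd
  ... | inj₁ a≡ | inj₁ c≡ = <⇒≢ (<-trans a<b b<c) (trans a≡ (sym c≡))
  ... | inj₁ a≡ | inj₂ d≡ = <⇒≢ (<-trans a<b (<-trans b<c c<d)) (trans a≡ (sym d≡))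
  ... | inj₂ b≡ | inj₁ c≡ = <⇒≢ b<c (trans b≡ (sym c≡))
  ... | inj₂ b≡ | inj₂ d≡ = <⇒≢ (<-trans b<c c<d) (trans b≡ (sym d≡))

separated⇒¬Overlapping : ∀ {x y p q o} → x ≤ o → y ≤ o → o ≤ p → o ≤ q → ¬ Overlapping x y p q
separated⇒¬Overlapping x≤o y≤o o≤p o≤q (inj₁ b) = right-of x≤o y≤o o≤p b
  where
  right-of : ∀ {z x y o} → x ≤ o → y ≤ o → o ≤ z → ¬ Between z x y
  right-of x≤o y≤o o≤z (inj₁ (_ , z<y)) = <⇒≱ z<y (≤-trans y≤o o≤z)
  right-of x≤o y≤o o≤z (inj₂ (_ , z<x)) = <⇒≱ z<x (≤-trans x≤o o≤z)
separated⇒¬Overlapping x≤o y≤o o≤p o≤q (inj₂ (inj₁ b)) =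
  separated⇒¬Overlapping x≤o y≤o o≤q o≤p (inj₁ b)
separated⇒¬Overlapping x≤o y≤o o≤p o≤q (inj₂ (inj₂ (inj₁ b))) = left-of x≤o o≤p o≤q b
  where
  left-of : ∀ {z x y o} → z ≤ o → o ≤ x → o ≤ y → ¬ Between z x y
  left-of z≤o o≤x o≤y (inj₁ (x<z , _)) = <⇒≱ x<z (≤-trans z≤o o≤x)
  left-of z≤o o≤x o≤y (inj₂ (y<z , _)) = <⇒≱ y<z (≤-trans z≤o o≤y)
separated⇒¬Overlapping x≤o y≤o o≤p o≤q (inj₂ (inj₂ (inj₂ b))) =
  separated⇒¬Overlapping y≤o x≤o o≤p o≤q (inj₂ (inj₂ (inj₁ b)))

⊕-untangled : ∀ G H → Untangled G → Untangled H → Untangled (G ⊕ H)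
⊕-untangled G H uG uH = record { unentangled = unentangled′ ; no-zigzag = no-zigzag′ }
  where
  o : ℕ
  o = size G ∸ 1
  left-≤ : ∀ {x y} → E G x y → x ≤ o × y ≤ o
  left-≤ e = <⇒≤pred (proj₁ (E-bound G e)) , <⇒≤pred (proj₂ (E-bound G e))
  shift-mono : ∀ {a b} → o ≤ a → o ≤ b → a < b → a ∸ o < b ∸ o
  shift-mono o≤a _ a<b = ∸-monoˡ-< a<b o≤a
  open StrictlyMonotoneOn (o ≤_) (_∸ o) shift-mono
  unentangled′ : ∀ {x y p q} → E (G ⊕ H) x y → E (G ⊕ H) p q → ¬ Entangled x y p q
  unentangled′ (_ , _ , inj₁ exy) (_ , _ , inj₁ epq) ent = Untangled.unentangled uG exy epq ent
  unentangled′ (_ , _ , inj₁ exy) (_ , _ , inj₂ (o≤p , o≤q , _)) (_ , ov) =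
    separated⇒¬Overlapping (proj₁ (left-≤ exy)) (proj₂ (left-≤ exy)) o≤p o≤q ov
  unentangled′ (_ , _ , inj₂ (o≤x , o≤y , _)) (_ , _ , inj₁ epq) ent =
    separated⇒¬Overlapping (proj₁ (left-≤ epq)) (proj₂ (left-≤ epq)) o≤x o≤y
      (proj₂ (Entangled-comm ent))
  unentangled′ (_ , _ , inj₂ (o≤x , o≤y , exy)) (_ , _ , inj₂ (o≤p , o≤q , epq)) ent =
    Untangled.unentangled uH exy epq (preserves-Entangled o≤x o≤y o≤p o≤q ent)
  no-zigzag′ : ∀ {a b c d} → a < b → b < c → c < d →
    E (G ⊕ H) a b → E (G ⊕ H) a d → E (G ⊕ H) c d → ⊥
  no-zigzag′ a<b b<c c<d (_ , _ , inj₁ eab) (_ , _ , inj₁ ead) (_ , _ , inj₁ ecd) =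
    Untangled.no-zigzag uG a<b b<c c<d eab ead ecd
  no-zigzag′ a<b b<c c<d (_ , _ , inj₂ (o≤a , o≤b , eab)) (_ , _ , inj₂ (_ , o≤d , ead))
    (_ , _ , inj₂ (o≤c , _ , ecd)) =
    Untangled.no-zigzag uH
      (shift-mono o≤a o≤b a<b) (shift-mono o≤b o≤c b<c) (shift-mono o≤c o≤d c<d) eab ead ecd
  no-zigzag′ a<b b<c c<d _ (_ , _ , inj₁ ead) (_ , _ , inj₂ (o≤c , _ , _)) =
    <⇒≱ c<d (≤-trans (proj₂ (left-≤ ead)) o≤c)
  no-zigzag′ a<b b<c c<d (_ , _ , inj₂ (o≤a , _ , _)) (_ , _ , inj₁ ead) _ =
    <⇒≱ (<-trans a<b (<-trans b<c c<d)) (≤-trans (proj₂ (left-≤ ead)) o≤a)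
  no-zigzag′ a<b b<c c<d (_ , _ , inj₁ eab) (_ , _ , inj₂ (o≤a , _ , _)) _ =
    <⇒≱ a<b (≤-trans (proj₂ (left-≤ eab)) o≤a)
  no-zigzag′ a<b b<c c<d (_ , _ , inj₂ _) (_ , _ , inj₂ (o≤a , _ , _)) (_ , _ , inj₁ ecd) =
    <⇒≱ (<-trans a<b (<-trans b<c c<d)) (≤-trans (proj₂ (left-≤ ecd)) o≤a)

chain-untangled : ∀ p ps → Untangled (chain p ps)
chain-untangled (l , r) [] = star-untangled l r
chain-untangled (l , r) (q ∷ qs) =
  ⊕-untangled (star l r) (chain q qs) (star-untangled l r) (chain-untangled q qs)

caterpillar⇒untangled : ∀ {G} → IsMonotoneCaterpillar G → Untangled G
caterpillar⇒untangled {G} (p , ps , _ , _ , G≅chain) =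
  Untangled-⊑ {G} {chain p ps} (≅⇒⊑ {G} {chain p ps} G≅chain) (chain-untangled p ps)

-- Walks and cycles

edge-≢ : ∀ {G x y} → E G x y → x ≢ y
edge-≢ {G} e refl = E-irr G e

E-bound-≡ : ∀ {G s i j} → size G ≡ s → E G i j → i < s × j < s
E-bound-≡ {G} refl = E-bound G

nth : List ℕ → ℕ → ℕ
nth [] _ = 0
nth (x ∷ xs) zero = x
nth (x ∷ xs) (suc i) = nth xs i

nth-∈ : ∀ xs {i} → i < length xs → nth xs i ∈ xs
nth-∈ (x ∷ xs) {zero} _ = here refl
nth-∈ (x ∷ xs) {suc i} (s≤s i<n) = there (nth-∈ xs i<n)

module _ {G : OGraph} where

  Reach-snoc : ∀ {i k j} → Reach G i k → E G k j → Reach G i j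
  Reach-snoc here e = step e here
  Reach-snoc (step e′ r) e = step e′ (Reach-snoc r e)

  Reach-trans : ∀ {i k j} → Reach G i k → Reach G k j → Reach G i j
  Reach-trans here r = r
  Reach-trans (step e r) r′ = step e (Reach-trans r r′)

  Reach-sym : ∀ {i j} → Reach G i j → Reach G j i
  Reach-sym here = here
  Reach-sym (step e r) = Reach-snoc (Reach-sym r) (E-sym G e)

  first-edge : ∀ {i j} → i ≢ j → Reach G i j → Σ ℕ λ k → E G i k
  first-edge i≢j here = ⊥-elim (i≢j refl)
  first-edge _ (step {k = k} e _) = k , e

  vertices : ∀ {i j} → Reach G i j → List ℕ
  vertices (here {i}) = i ∷ []
  vertices (step {i} e r) = i ∷ vertices r

  Simple : ∀ {i j} → Reach G i j → Set
  Simple here = ⊤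
  Simple (step {i} e r) = i ∉ vertices r × Simple r

  simple-suffix : ∀ {k j x} (r : Reach G k j) → x ∈ vertices r → Simple r →
    Σ (Reach G x j) Simple
  simple-suffix here (here refl) s = here , tt
  simple-suffix (step e r) (here refl) s = step e r , s
  simple-suffix (step e r) (there x∈r) (_ , s) = simple-suffix r x∈r s

  simplify : ∀ {i j} → Reach G i j → Σ (Reach G i j) Simple
  simplify here = here , tt
  simplify (step {i} e r) with simplify r
  ... | r′ , s′ with i ∈? vertices r′
  ... | yes i∈r′ = simple-suffix r′ i∈r′ s′
  ... | no i∉r′ = step e r′ , i∉r′ , s′

  vertices-nonempty : ∀ {i j} (r : Reach G i j) → 1 ≤ length (vertices r)
  vertices-nonempty here = s≤s z≤n
  vertices-nonempty (step e r) = s≤s z≤n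

  nth-vertices-head : ∀ {i j} (r : Reach G i j) → nth (vertices r) 0 ≡ i
  nth-vertices-head here = refl
  nth-vertices-head (step e r) = refl

  nth-vertices-last : ∀ {i j} (r : Reach G i j) → nth (vertices r) (length (vertices r) ∸ 1) ≡ j
  nth-vertices-last here = refl
  nth-vertices-last (step e here) = refl
  nth-vertices-last (step e (step e′ r)) = nth-vertices-last (step e′ r)

  nth-vertices-edge : ∀ {i j} (r : Reach G i j) {a} → suc a < length (vertices r) →
    E G (nth (vertices r) a) (nth (vertices r) (suc a))
  nth-vertices-edge here (s≤s ())
  nth-vertices-edge (step e r) {zero} _ = subst (E G _) (sym (nth-vertices-head r)) e
  nth-vertices-edge (step e r) {suc a} (s≤s a<n) = nth-vertices-edge r a<n

  nth-vertices-bound : ∀ {i j} → i < size G → (r : Reach G i j) → ∀ {a} → a < length (vertices r) →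
    nth (vertices r) a < size G
  nth-vertices-bound i<n here {zero} _ = i<n
  nth-vertices-bound i<n here {suc a} (s≤s ())
  nth-vertices-bound i<n (step e r) {zero} _ = i<n
  nth-vertices-bound i<n (step e r) {suc a} (s≤s a<n) =
    nth-vertices-bound (proj₂ (E-bound G e)) r a<n

  nth-vertices-injective : ∀ {i j} (r : Reach G i j) → Simple r → ∀ {a b} →
    a < length (vertices r) → b < length (vertices r) →
    nth (vertices r) a ≡ nth (vertices r) b → a ≡ b
  nth-vertices-injective here _ {zero} {zero} _ _ _ = refl
  nth-vertices-injective here _ {suc a} (s≤s ()) _ _
  nth-vertices-injective here _ {zero} {suc b} _ (s≤s ()) _
  nth-vertices-injective (step e r) _ {zero} {zero} _ _ _ = refl
  nth-vertices-injective (step e r) (i∉r , _) {zero} {suc b} _ (s≤s b<n) eq =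
    ⊥-elim (i∉r (subst (_∈ vertices r) (sym eq) (nth-∈ (vertices r) b<n)))
  nth-vertices-injective (step e r) (i∉r , _) {suc a} {zero} (s≤s a<n) _ eq =
    ⊥-elim (i∉r (subst (_∈ vertices r) eq (nth-∈ (vertices r) a<n)))
  nth-vertices-injective (step e r) (_ , s) {suc a} {suc b} (s≤s a<n) (s≤s b<n) eq =
    cong suc (nth-vertices-injective r s a<n b<n eq)

  closing-edge⇒cycle : ∀ {i k l j} (e₁ : E G i k) (e₂ : E G k l) (r : Reach G l j) →
    Simple (step e₁ (step e₂ r)) → E G j i → HasCycle G
  closing-edge⇒cycle e₁ e₂ r s eji =
    length (vertices w) , nth (vertices w) , s≤s (s≤s (vertices-nonempty r)) ,
    (λ a → nth-vertices-bound (proj₁ (E-bound G e₁)) w) ,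
    (λ a b → nth-vertices-injective w s) ,
    (λ a → nth-vertices-edge w) ,
    subst₂ (E G) (sym (nth-vertices-last w)) (sym (nth-vertices-head w)) eji
    where
    w : Reach G _ _
    w = step e₁ (step e₂ r)

  triangle⇒cycle : ∀ {x y z} → E G x y → E G y z → E G z x → x ≢ z → HasCycle G
  triangle⇒cycle {x} {y} {z} exy eyz ezx x≢z =
    closing-edge⇒cycle exy eyz here (x∉ , y∉ , tt) ezx
    where
    x∉ : x ∉ y ∷ z ∷ []
    x∉ (here x≡y) = edge-≢ {G} exy x≡y
    x∉ (there (here x≡z)) = x≢z x≡z
    y∉ : y ∉ z ∷ []
    y∉ (here y≡z) = edge-≢ {G} eyz y≡z

  tree-edge? : IsTree G → ∀ i j → Dec (E G i j)
  tree-edge? ((_ , connected) , acyclic) i j with i <? size G | j <? size G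
  ... | no i≮n | _ = no λ e → i≮n (proj₁ (E-bound G e))
  ... | yes _ | no j≮n = no λ e → j≮n (proj₂ (E-bound G e))
  ... | yes i<n | yes j<n with simplify (connected i j i<n j<n)
  ... | here , _ = no (E-irr G)
  ... | step e here , _ = yes e
  ... | step e₁ (step e₂ r) , s = no λ eij → acyclic (closing-edge⇒cycle e₁ e₂ r s (E-sym G eij))

acyclic-⊑ : ∀ {H G} → H ⊑ G → HasCycle H → HasCycle G
acyclic-⊑ {H} {G} (φ , φ-bound , φ-mono , φ-edge)
  (k , v , 3≤k , v-bound , v-inj , v-edge , v-close) =
  k , (λ a → φ (v a)) , 3≤k , (λ a a<k → φ-bound (v a) (v-bound a a<k)) ,
  (λ a b a<k b<k eq → v-inj a b a<k b<k (injective (v-bound a a<k) (v-bound b b<k) eq)) ,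
  (λ a a<k → φ-edge _ _ (v-edge a a<k)) , φ-edge _ _ v-close
  where
  open StrictlyMonotoneOn (_< size H) φ (λ {a} {b} _ b<n a<b → φ-mono a b a<b b<n)

-- Ordered subgraphs induced on finite vertex sets

nth-strict : ∀ {ys} → AllPairs _<_ ys → ∀ {i j} → i < j → j < length ys → nth ys i < nth ys j
nth-strict {y ∷ ys} (y<ys ∷ _) {zero} {suc j} _ (s≤s j<n) = All.lookup y<ys (nth-∈ ys j<n)
nth-strict {y ∷ ys} (_ ∷ ys<) {suc i} {suc j} (s≤s i<j) (s≤s j<n) = nth-strict ys< i<j j<n

nth-index : ∀ {ys x} → x ∈ ys → Σ ℕ λ i → i < length ys × nth ys i ≡ x
nth-index (here refl) = 0 , s≤s z≤n , refl
nth-index (there x∈ys) with nth-index x∈ys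
... | i , i<n , eq = suc i , s≤s i<n , eq

module SortedEnumeration (xs : List ℕ) (distinct : Unique xs) where

  private
    ys : List ℕ
    ys = sort xs
    length-ys : length ys ≡ length xs
    length-ys = ↭-length (sort-↭ xs)
    increasing : AllPairs _<_ ys
    increasing = AllPairs.zipWith (λ (x≤y , x≢y) → ≤∧≢⇒< x≤y x≢y)
      ( Linked⇒AllPairs ≤-trans (sort-↗ xs)
      , Permutationₛ.Unique-resp-↭ (setoid ℕ) (↭⇒↭ₛ (↭-sym (sort-↭ xs))) distinct )

  at : ℕ → ℕ
  at = nth ys

  at-strict : ∀ {i j} → i < j → j < length xs → at i < at j
  at-strict i<j j<n = nth-strict increasing i<j (subst (_ <_) (sym length-ys) j<n)

  at-∈ : ∀ {i} → i < length xs → at i ∈ xs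
  at-∈ i<n = ∈-resp-↭ (sort-↭ xs) (nth-∈ ys (subst (_ <_) (sym length-ys) i<n))

  index : ∀ {x} → x ∈ xs → Σ ℕ λ i → i < length xs × at i ≡ x
  index x∈xs with nth-index (∈-resp-↭ (↭-sym (sort-↭ xs)) x∈xs)
  ... | i , i<n , eq = i , subst (i <_) length-ys i<n , eq

cong-Entangled : ∀ {x y p q x′ y′ p′ q′} → x ≡ x′ → y ≡ y′ → p ≡ p′ → q ≡ q′ →
  Entangled x y p q → Entangled x′ y′ p′ q′
cong-Entangled refl refl refl refl ent = ent

module Induced (G : OGraph) (xs : List ℕ) (distinct : Unique xs)
  (in-range : All.All (_< size G) xs) where

  open SortedEnumeration xs distinct public

  n : ℕ
  n = length xs

  induced : OGraph
  induced = record
    { size = n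
    ; E = λ i j → i < n × j < n × E G (at i) (at j)
    ; E-sym = λ (i<n , j<n , e) → j<n , i<n , E-sym G e
    ; E-irr = λ (_ , _ , e) → E-irr G e
    ; E-bound = λ (i<n , j<n , _) → i<n , j<n
    }

  induced-⊑ : induced ⊑ G
  induced-⊑ =
    at , (λ i i<n → All.lookup in-range (at-∈ i<n)) , (λ i j → at-strict) , λ i j → proj₂ ∘ proj₂

  pos : ∀ {x} → x ∈ xs → ℕ
  pos x∈xs = proj₁ (index x∈xs)

  pos<n : ∀ {x} (x∈xs : x ∈ xs) → pos x∈xs < n
  pos<n x∈xs = proj₁ (proj₂ (index x∈xs))

  at-pos : ∀ {x} (x∈xs : x ∈ xs) → at (pos x∈xs) ≡ x
  at-pos x∈xs = proj₂ (proj₂ (index x∈xs))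

  open StrictlyMonotoneOn (_< n) at (λ _ j<n i<j → at-strict i<j j<n)

  lift-edge : ∀ {x y} (x∈xs : x ∈ xs) (y∈xs : y ∈ xs) → E G x y → E induced (pos x∈xs) (pos y∈xs)
  lift-edge x∈xs y∈xs e =
    pos<n x∈xs , pos<n y∈xs , subst₂ (E G) (sym (at-pos x∈xs)) (sym (at-pos y∈xs)) e

  lift-< : ∀ {x y} (x∈xs : x ∈ xs) (y∈xs : y ∈ xs) → x < y → pos x∈xs < pos y∈xs
  lift-< x∈xs y∈xs x<y =
    reflects-< (pos<n x∈xs) (pos<n y∈xs) (subst₂ _<_ (sym (at-pos x∈xs)) (sym (at-pos y∈xs)) x<y)

  lift-Entangled : ∀ {x y p q} (x∈xs : x ∈ xs) (y∈xs : y ∈ xs) (p∈xs : p ∈ xs) (q∈xs : q ∈ xs) →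
    Entangled x y p q → Entangled (pos x∈xs) (pos y∈xs) (pos p∈xs) (pos q∈xs)
  lift-Entangled x∈xs y∈xs p∈xs q∈xs ent =
    reflects-Entangled (pos<n x∈xs) (pos<n y∈xs) (pos<n p∈xs) (pos<n q∈xs)
      (cong-Entangled (sym (at-pos x∈xs)) (sym (at-pos y∈xs)) (sym (at-pos p∈xs)) (sym (at-pos q∈xs))
        ent)

-- Four-vertex obstructions

ObstructionFree : OGraph → Set₁
ObstructionFree G = ∀ T → IsTree T → size T ≡ 4 → ¬ IsMonotoneCaterpillar T → ¬ (T ⊑ G)

module FourPath {G : OGraph} (acyclic : ¬ HasCycle G) {u₀ u₁ u₂ u₃ : ℕ}
  (e₀₁ : E G u₀ u₁) (e₁₂ : E G u₁ u₂) (e₂₃ : E G u₂ u₃)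
  (distinct : Unique (u₀ ∷ u₁ ∷ u₂ ∷ u₃ ∷ [])) where

  us : List ℕ
  us = u₀ ∷ u₁ ∷ u₂ ∷ u₃ ∷ []

  open Induced G us distinct
    ( proj₁ (E-bound G e₀₁) ∷ proj₁ (E-bound G e₁₂) ∷ proj₁ (E-bound G e₂₃)
    ∷ proj₂ (E-bound G e₂₃) ∷ [])
    public

  ∈₀ : u₀ ∈ us
  ∈₀ = here refl
  ∈₁ : u₁ ∈ us
  ∈₁ = there (here refl)
  ∈₂ : u₂ ∈ us
  ∈₂ = there (there (here refl))
  ∈₃ : u₃ ∈ us
  ∈₃ = there (there (there (here refl)))

  private
    edge-from : ∀ {i x y} → i < 4 → at i ≡ x → (y∈us : y ∈ us) → E G x y → E induced i (pos y∈us)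
    edge-from i<4 at≡x y∈us e = i<4 , pos<n y∈us , subst₂ (E G) (sym at≡x) (sym (at-pos y∈us)) e

    reach-u₁ : ∀ i → i < 4 → Reach induced i (pos ∈₁)
    reach-u₁ i i<4 with at-∈ i<4
    ... | here at≡u₀ = step (edge-from i<4 at≡u₀ ∈₁ e₀₁) here
    ... | there (here at≡u₁) =
      step (edge-from i<4 at≡u₁ ∈₀ (E-sym G e₀₁)) (step (lift-edge ∈₀ ∈₁ e₀₁) here)
    ... | there (there (here at≡u₂)) = step (edge-from i<4 at≡u₂ ∈₁ (E-sym G e₁₂)) here
    ... | there (there (there (here at≡u₃))) =
      step (edge-from i<4 at≡u₃ ∈₂ (E-sym G e₂₃)) (step (lift-edge ∈₂ ∈₁ (E-sym G e₁₂)) here)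

  induced-tree : IsTree induced
  induced-tree =
    (s≤s z≤n , λ i j i<4 j<4 → Reach-trans (reach-u₁ i i<4) (Reach-sym (reach-u₁ j j<4))) ,
    λ cycle → acyclic (acyclic-⊑ {induced} {G} induced-⊑ cycle)

module _ {G : OGraph} (tree : IsTree G) (free : ObstructionFree G) where

  obstruction-free⇒no-entangled-path : ∀ {a b c d} → E G a b → E G b c → E G c d →
    ¬ Entangled a b c d
  obstruction-free⇒no-entangled-path eab ebc ecd ent@((a≢c , a≢d , b≢c , b≢d) , _) =
    free induced induced-tree refl
      (λ caterpillar → Untangled.unentangled (caterpillar⇒untangled {induced} caterpillar)
         (lift-edge ∈₀ ∈₁ eab) (lift-edge ∈₂ ∈₃ ecd) (lift-Entangled ∈₀ ∈₁ ∈₂ ∈₃ ent))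
      induced-⊑
    where
    open FourPath {G} (proj₂ tree) eab ebc ecd
      ((edge-≢ {G} eab ∷ a≢c ∷ a≢d ∷ []) ∷ (b≢c ∷ b≢d ∷ []) ∷ (edge-≢ {G} ecd ∷ []) ∷ [] ∷ [])

  obstruction-free⇒no-zigzag : ∀ {a b c d} → a < b → b < c → c < d → E G a b → E G a d → E G c d → ⊥
  obstruction-free⇒no-zigzag {a} {b} {c} {d} a<b b<c c<d eab ead ecd =
    free induced induced-tree refl
      (λ caterpillar → Untangled.no-zigzag (caterpillar⇒untangled {induced} caterpillar)
         (lift-< ∈₁ ∈₀ a<b) (lift-< ∈₀ ∈₃ b<c) (lift-< ∈₃ ∈₂ c<d)
         (lift-edge ∈₁ ∈₀ eab) (lift-edge ∈₁ ∈₂ ead) (lift-edge ∈₃ ∈₂ ecd))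
      induced-⊑
    where
    b<d : b < d
    b<d = <-trans b<c c<d
    open FourPath {G} (proj₂ tree) (E-sym G eab) ead (E-sym G ecd)
      ((≢-sym (<⇒≢ a<b) ∷ <⇒≢ b<d ∷ <⇒≢ b<c ∷ []) ∷
       (<⇒≢ (<-trans a<b b<d) ∷ <⇒≢ (<-trans a<b b<c) ∷ []) ∷
       (≢-sym (<⇒≢ c<d) ∷ []) ∷ [] ∷ [])

-- Entangled edges joined by walks

hits-or-jumps : ∀ L (v : ℕ → ℕ) {t} → Between t (v 0) (v L) →
  (Σ ℕ λ i → i ≤ L × v i ≡ t) ⊎ (Σ ℕ λ i → i < L × Between t (v i) (v (suc i)))
hits-or-jumps zero v between = ⊥-elim (Between-irrefl between)
hits-or-jumps (suc L) v {t} between with v 1 ≟ t | Between? t (v 0) (v 1)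
... | yes v₁≡t | _ = inj₁ (1 , s≤s z≤n , v₁≡t)
... | no _ | yes jump = inj₂ (0 , s≤s z≤n , jump)
... | no v₁≢t | no ¬jump with hits-or-jumps L (λ i → v (suc i)) (Between-move between ¬jump v₁≢t)
...   | inj₁ (i , i≤L , hit) = inj₁ (suc i , s≤s i≤L , hit)
...   | inj₂ (i , i<L , jump) = inj₂ (suc i , s≤s i<L , jump)

Interleaved : ℕ → ℕ → ℕ → ℕ → Set
Interleaved x y p q = (p < y × y < q × q < x) ⊎ (x < q × q < y × y < p)

entangled⇒interleaved : ∀ {x y p q} → Entangled x y p q → ¬ Between p x y → ¬ Between x p q →
  Interleaved x y p q
entangled⇒interleaved (_ , inj₁ pxy) ¬pxy _ = ⊥-elim (¬pxy pxy)
entangled⇒interleaved (_ , inj₂ (inj₂ (inj₁ xpq))) _ ¬xpq = ⊥-elim (¬xpq xpq)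
entangled⇒interleaved {x} {y} {p} ((x≢p , _ , y≢p , _) , inj₂ (inj₁ (inj₁ (x<q , q<y)))) ¬pxy ¬xpq
  with <-cmp p x
... | tri< p<x _ _ = ⊥-elim (¬xpq (inj₁ (p<x , x<q)))
... | tri≈ _ p≡x _ = ⊥-elim (x≢p (sym p≡x))
... | tri> _ _ x<p with <-cmp p y
...   | tri< p<y _ _ = ⊥-elim (¬pxy (inj₁ (x<p , p<y)))
...   | tri≈ _ p≡y _ = ⊥-elim (y≢p (sym p≡y))
...   | tri> _ _ y<p = inj₂ (x<q , q<y , y<p)
entangled⇒interleaved {x} {y} {p} ((x≢p , _ , y≢p , _) , inj₂ (inj₁ (inj₂ (y<q , q<x)))) ¬pxy ¬xpq
  with <-cmp p y
... | tri< p<y _ _ = inj₁ (p<y , y<q , q<x)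
... | tri≈ _ p≡y _ = ⊥-elim (y≢p (sym p≡y))
... | tri> _ _ y<p with <-cmp p x
...   | tri< p<x _ _ = ⊥-elim (¬pxy (inj₂ (y<p , p<x)))
...   | tri≈ _ p≡x _ = ⊥-elim (x≢p (sym p≡x))
...   | tri> _ _ x<p = ⊥-elim (¬xpq (inj₂ (q<x , x<p)))
entangled⇒interleaved {x} {y} {p} {q} ((x≢p , x≢q , _ , _) , inj₂ (inj₂ (inj₂ (inj₁ (p<y , y<q)))))
  ¬pxy ¬xpq with <-cmp x p
... | tri< x<p _ _ = ⊥-elim (¬pxy (inj₁ (x<p , p<y)))
... | tri≈ _ x≡p _ = ⊥-elim (x≢p x≡p)
... | tri> _ _ p<x with <-cmp x q
...   | tri< x<q _ _ = ⊥-elim (¬xpq (inj₁ (p<x , x<q)))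
...   | tri≈ _ x≡q _ = ⊥-elim (x≢q x≡q)
...   | tri> _ _ q<x = inj₁ (p<y , y<q , q<x)
entangled⇒interleaved {x} {y} {p} {q} ((x≢p , x≢q , _ , _) , inj₂ (inj₂ (inj₂ (inj₂ (q<y , y<p)))))
  ¬pxy ¬xpq with <-cmp x q
... | tri< x<q _ _ = inj₂ (x<q , q<y , y<p)
... | tri≈ _ x≡q _ = ⊥-elim (x≢q x≡q)
... | tri> _ _ q<x with <-cmp x p
...   | tri< x<p _ _ = ⊥-elim (¬xpq (inj₂ (q<x , x<p)))
...   | tri≈ _ x≡p _ = ⊥-elim (x≢p x≡p)
...   | tri> _ _ p<x = ⊥-elim (¬pxy (inj₂ (y<p , p<x)))

interleaved⇒Between : ∀ {x y p q u w} → Interleaved x y p q →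
  ¬ Between y u p → u ≢ y → ¬ Between q w x → w ≢ q → Between y u w
interleaved⇒Between {y = y} {q = q} {u = u} {w = w} (inj₁ (p<y , y<q , q<x)) ¬yup u≢y ¬qwx w≢q
  with <-cmp u y | <-cmp w q
... | tri≈ _ u≡y _ | _ = ⊥-elim (u≢y u≡y)
... | tri> _ _ y<u | _ = ⊥-elim (¬yup (inj₂ (p<y , y<u)))
... | _ | tri≈ _ w≡q _ = ⊥-elim (w≢q w≡q)
... | _ | tri< w<q _ _ = ⊥-elim (¬qwx (inj₁ (w<q , q<x)))
... | tri< u<y _ _ | tri> _ _ q<w = inj₁ (u<y , <-trans y<q q<w)
interleaved⇒Between {y = y} {q = q} {u = u} {w = w} (inj₂ (x<q , q<y , y<p)) ¬yup u≢y ¬qwx w≢q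
  with <-cmp u y | <-cmp w q
... | tri≈ _ u≡y _ | _ = ⊥-elim (u≢y u≡y)
... | tri< u<y _ _ | _ = ⊥-elim (¬yup (inj₁ (u<y , y<p)))
... | _ | tri≈ _ w≡q _ = ⊥-elim (w≢q w≡q)
... | _ | tri> _ _ q<w = ⊥-elim (¬qwx (inj₂ (x<q , q<w)))
... | tri> _ _ y<u | tri< w<q _ _ = inj₂ (<-trans w<q q<y , y<u)

Walk : OGraph → (ℕ → ℕ) → ℕ → Set
Walk G v L = ∀ {i} → i < L → E G (v i) (v (suc i))

reach⇒walk : ∀ {G u w} → Reach G u w →
  Σ ℕ λ L → Σ (ℕ → ℕ) λ v → v 0 ≡ u × v L ≡ w × Walk G v L
reach⇒walk {u = u} here = 0 , (λ _ → u) , refl , refl , λ ()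
reach⇒walk {G} {u} (step e r) with reach⇒walk r
... | L , v , v₀≡k , v_L≡w , walk = suc L , v′ , refl , v_L≡w , walk′
  where
  v′ : ℕ → ℕ
  v′ zero = u
  v′ (suc i) = v i
  walk′ : Walk G v′ (suc L)
  walk′ {zero} _ = subst (E G u) (sym v₀≡k) e
  walk′ {suc i} (s≤s i<L) = walk i<L

walk-prefix : ∀ {G v L i} → i ≤ L → Walk G v L → Walk G v i
walk-prefix i≤L walk j<i = walk (<-≤-trans j<i i≤L)

walk-suffix : ∀ {G v L} i → i ≤ L → Walk G v L → Walk G (λ j → v (j + i)) (L ∸ i)
walk-suffix i i≤L walk {j} j<L∸i = walk (m≤o∸n⇒m+n≤o (suc j) i≤L j<L∸i)

module _ {G : OGraph} (tree : IsTree G) (free : ObstructionFree G) where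

  JoinedBy : ℕ → Set
  JoinedBy L = ∀ {v x y p q} → Walk G v L → v 0 ≡ p → v L ≡ x → E G x y → E G p q →
    ¬ Entangled x y p q

  -- Induction step for walks of length at least two: a walk from p to x first steps to u
  -- and last steps from w.  By induction pu stays apart from xy and wx apart from pq,
  -- which forces the walk from u to w to pass over y, and the edge passing over y
  -- is entangled with xy and joined to it by a shorter walk.
  joined-by-long : ∀ K → (∀ {L} → L < suc (suc K) → JoinedBy L) → JoinedBy (suc (suc K))
  joined-by-long K shorter {v} {x} {y} {p} {q} walk v₀≡p v_L≡x exy epq
    ent@((x≢p , x≢q , y≢p , y≢q) , _) =
    passes-over-y (hits-or-jumps K (λ j → v (suc j)) (interleaved⇒Between layout ¬yup u≢y ¬qwx w≢q))
    where
    L : ℕ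
    L = suc (suc K)
    via-prefix : ∀ {i x′ y′} → i < L → v i ≡ x′ → E G x′ y′ → ¬ Entangled x′ y′ p q
    via-prefix i<L vᵢ≡x′ e = shorter i<L {v} (walk-prefix {G} {v} (<⇒≤ i<L) walk) v₀≡p vᵢ≡x′ e epq
    via-suffix : ∀ {i p′ q′} → 0 < i → i ≤ L → v i ≡ p′ → E G p′ q′ → ¬ Entangled x y p′ q′
    via-suffix {i} 0<i i≤L vᵢ≡p′ e =
      shorter (∸-monoʳ-< 0<i i≤L) {λ j → v (j + i)} (walk-suffix {G} {v} i i≤L walk)
        vᵢ≡p′ (trans (cong v (m∸n+n≡m i≤L)) v_L≡x) exy e
    x≢ : ∀ {i} → i < L → x ≢ v i
    x≢ i<L x≡vᵢ = via-prefix i<L (sym x≡vᵢ) exy ent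
    u≢y : v 1 ≢ y
    u≢y u≡y = via-prefix (s≤s (s≤s z≤n)) u≡y (E-sym G exy) (Entangled-swapˡ ent)
    w≢p : v (suc K) ≢ p
    w≢p w≡p = via-suffix (s≤s z≤n) (n≤1+n _) w≡p epq ent
    w≢q : v (suc K) ≢ q
    w≢q w≡q = via-suffix (s≤s z≤n) (n≤1+n _) w≡q (E-sym G epq) (Entangled-swapʳ ent)
    ¬Overlapping-xyup : ¬ Overlapping x y (v 1) p
    ¬Overlapping-xyup ov =
      via-suffix (s≤s z≤n) (s≤s z≤n) refl (subst (E G (v 1)) v₀≡p (E-sym G (walk (s≤s z≤n))))
        ((x≢ (s≤s (s≤s z≤n)) , x≢p , u≢y ∘ sym , y≢p) , ov)
    ¬Overlapping-wxpq : ¬ Overlapping (v (suc K)) x p q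
    ¬Overlapping-wxpq ov = via-prefix ≤-refl refl (subst (E G (v (suc K))) v_L≡x (walk ≤-refl))
      ((w≢p , w≢q , x≢p , x≢q) , ov)
    ¬yup : ¬ Between y (v 1) p
    ¬yup b = ¬Overlapping-xyup (inj₂ (inj₂ (inj₂ b)))
    ¬qwx : ¬ Between q (v (suc K)) x
    ¬qwx b = ¬Overlapping-wxpq (inj₂ (inj₁ b))
    layout : Interleaved x y p q
    layout = entangled⇒interleaved ent (λ b → ¬Overlapping-xyup (inj₂ (inj₁ b)))
      (λ b → ¬Overlapping-wxpq (inj₂ (inj₂ (inj₂ b))))
    passes-over-y : (Σ ℕ λ j → j ≤ K × v (suc j) ≡ y) ⊎
                    (Σ ℕ λ j → j < K × Between y (v (suc j)) (v (suc (suc j)))) → ⊥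
    passes-over-y (inj₁ (j , j≤K , hit)) =
      via-prefix (s≤s (s≤s j≤K)) hit (E-sym G exy) (Entangled-swapˡ ent)
    passes-over-y (inj₂ (j , j<K , jump)) =
      via-suffix (s≤s z≤n) (s≤s (s≤s (<⇒≤ j<K))) refl (E-sym G (walk (s≤s (s≤s (<⇒≤ j<K)))))
        ( (x≢ (s≤s (s≤s j<K)) , x≢ (s≤s (s≤s (<⇒≤ j<K))) ,
           Between⇒≢ʳ jump , Between⇒≢ˡ jump)
        , inj₂ (inj₂ (inj₂ (Between-sym jump))))

  joined-by : ∀ L → JoinedBy L
  joined-by = <-rec JoinedBy λ
    { zero _ _ v₀≡p v₀≡x _ _ ((x≢p , _) , _) → x≢p (trans (sym v₀≡x) v₀≡p)
    ; (suc zero) _ walk v₀≡p v₁≡x exy epq ent →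
        obstruction-free⇒no-entangled-path tree free
          (E-sym G epq) (subst₂ (E G) v₀≡p v₁≡x (walk (s≤s z≤n))) exy
          (Entangled-comm (Entangled-swapʳ ent))
    ; (suc (suc K)) shorter → joined-by-long K shorter
    }

  obstruction-free⇒untangled : Untangled G
  obstruction-free⇒untangled = record
    { unentangled = unentangled′
    ; no-zigzag = obstruction-free⇒no-zigzag tree free
    }
    where
    unentangled′ : ∀ {x y p q} → E G x y → E G p q → ¬ Entangled x y p q
    unentangled′ {x} {p = p} exy epq
      with reach⇒walk (proj₂ (proj₁ tree) p x (proj₁ (E-bound G epq)) (proj₁ (E-bound G exy)))
    ... | L , v , v₀≡p , v_L≡x , walk = joined-by L walk v₀≡p v_L≡x exy epq

-- Cutting at uncrossed vertices

least-witness : ∀ {P : ℕ → Set} → Decidable P → ∀ n → (∃ λ k → k ≤ n × P k) →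
  ∃ λ k → k ≤ n × P k × (∀ {j} → j < k → ¬ P j)
least-witness P? zero (.zero , z≤n , P0) = 0 , z≤n , P0 , λ ()
least-witness P? (suc n) (k , k≤1+n , Pk) with anyUpTo? P? (suc n)
... | yes (j , s≤s j≤n , Pj) with least-witness P? n (j , j≤n , Pj)
...   | l , l≤n , Pl , below = l , m≤n⇒m≤1+n l≤n , Pl , below
least-witness P? (suc n) (k , k≤1+n , Pk) | no none with m≤n⇒m<n∨m≡n k≤1+n
...   | inj₁ k<1+n = ⊥-elim (none (k , k<1+n , Pk))
...   | inj₂ refl = k , ≤-refl , Pk , λ j<k Pj → none (_ , j<k , Pj)

n∸1<n : ∀ {n} → 1 ≤ n → n ∸ 1 < n
n∸1<n (s≤s _) = ≤-refl

greatest-witness : ∀ {P : ℕ → Set} → Decidable P → ∀ n → (∃ λ k → k < n × P k) →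
  ∃ λ b → P b × (∀ {j} → b < j → j < n → ¬ P j)
greatest-witness {P} P? (suc n) (k , k<1+n , Pk) with P? n
... | yes Pn = n , Pn , λ n<j j<1+n → ⊥-elim (<⇒≱ n<j (≤-pred j<1+n))
... | no ¬Pn with m≤n⇒m<n∨m≡n (≤-pred k<1+n)
...   | inj₂ refl = ⊥-elim (¬Pn Pk)
...   | inj₁ k<n with greatest-witness P? n (k , k<n , Pk)
...     | b , Pb , above = b , Pb , beyond
  where
  beyond : ∀ {j} → b < j → j < suc n → ¬ P j
  beyond b<j j<1+n with m≤n⇒m<n∨m≡n (≤-pred j<1+n)
  ... | inj₁ j<n = above b<j j<n
  ... | inj₂ refl = ¬Pn

Crossed : OGraph → ℕ → Set
Crossed G c = ∃ λ i → i < c × ∃ λ j → j < size G × c < j × E G i j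

Crossed? : ∀ {G} → (∀ i j → Dec (E G i j)) → ∀ c → Dec (Crossed G c)
Crossed? {G} E? c = anyUpTo? (λ i → anyUpTo? (λ j → (c <? j) ×-dec E? i j) (size G)) c

module _ {G : OGraph} {c : ℕ} (uncrossed : ¬ Crossed G c) where

  cut-side : ∀ {x y} → E G x y → (x ≤ c × y ≤ c) ⊎ (c ≤ x × c ≤ y)
  cut-side {x} {y} e with x ≤? c | y ≤? c
  ... | yes x≤c | yes y≤c = inj₁ (x≤c , y≤c)
  ... | no x≰c | no y≰c = inj₂ (<⇒≤ (≰⇒> x≰c) , <⇒≤ (≰⇒> y≰c))
  ... | yes x≤c | no y≰c with m≤n⇒m<n∨m≡n x≤c
  ...   | inj₁ x<c = ⊥-elim (uncrossed (x , x<c , y , proj₂ (E-bound G e) , ≰⇒> y≰c , e))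
  ...   | inj₂ refl = inj₂ (≤-refl , <⇒≤ (≰⇒> y≰c))
  cut-side {x} {y} e | no x≰c | yes y≤c with m≤n⇒m<n∨m≡n y≤c
  ...   | inj₁ y<c = ⊥-elim (uncrossed (y , y<c , x , proj₁ (E-bound G e) , ≰⇒> x≰c , E-sym G e))
  ...   | inj₂ refl = inj₂ (<⇒≤ (≰⇒> x≰c) , ≤-refl)

left : OGraph → ℕ → OGraph
left G c = record
  { size = suc c
  ; E = λ i j → E G i j × i ≤ c × j ≤ c
  ; E-sym = λ (e , i≤c , j≤c) → E-sym G e , j≤c , i≤c
  ; E-irr = λ (e , _ , _) → E-irr G e
  ; E-bound = λ (_ , i≤c , j≤c) → s≤s i≤c , s≤s j≤c
  }

right : OGraph → ℕ → OGraph
right G c = record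
  { size = size G ∸ c
  ; E = λ i j → E G (i + c) (j + c)
  ; E-sym = E-sym G
  ; E-irr = E-irr G
  ; E-bound = λ e →
      m+n≤o⇒m≤o∸n (suc _) (proj₁ (E-bound G e)) , m+n≤o⇒m≤o∸n (suc _) (proj₂ (E-bound G e))
  }

left-⊑ : ∀ G c → c < size G → left G c ⊑ G
left-⊑ G c c<n =
  (λ i → i) , (λ i i≤c → ≤-<-trans (≤-pred i≤c) c<n) , (λ i j i<j _ → i<j) , λ i j → proj₁

right-⊑ : ∀ G c → c ≤ size G → right G c ⊑ G
right-⊑ G c c≤n =
  (λ i → i + c) , (λ i i<n∸c → m≤o∸n⇒m+n≤o (suc i) c≤n i<n∸c) , (λ i j i<j _ → +-monoˡ-< c i<j) ,
  λ i j e → e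

Reach-map : ∀ {G H} (π : ℕ → ℕ) → (∀ {x y} → E G x y → π x ≡ π y ⊎ E H (π x) (π y)) →
  ∀ {i j} → Reach G i j → Reach H (π i) (π j)
Reach-map π π-edge here = here
Reach-map {H = H} π π-edge (step {j = j} e r) with π-edge e
... | inj₁ πx≡πy = subst (λ t → Reach H t (π j)) (sym πx≡πy) (Reach-map π π-edge r)
... | inj₂ e′ = step e′ (Reach-map π π-edge r)

module _ {G : OGraph} (tree : IsTree G) {c : ℕ} (c<n : c < size G) (uncrossed : ¬ Crossed G c) where

  private
    connected : ∀ i j → i < size G → j < size G → Reach G i j
    connected = proj₂ (proj₁ tree)

  left-tree : IsTree (left G c)
  left-tree = (s≤s z≤n , connected′) ,
    λ cycle → proj₂ tree (acyclic-⊑ {left G c} {G} (left-⊑ G c c<n) cycle)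
    where
    clamp : ∀ {x y} → E G x y → x ⊓ c ≡ y ⊓ c ⊎ E (left G c) (x ⊓ c) (y ⊓ c)
    clamp e with cut-side {G} uncrossed e
    ... | inj₁ (x≤c , y≤c) rewrite m≤n⇒m⊓n≡m x≤c | m≤n⇒m⊓n≡m y≤c = inj₂ (e , x≤c , y≤c)
    ... | inj₂ (c≤x , c≤y) rewrite m≥n⇒m⊓n≡n c≤x | m≥n⇒m⊓n≡n c≤y = inj₁ refl
    connected′ : ∀ i j → i < suc c → j < suc c → Reach (left G c) i j
    connected′ i j (s≤s i≤c) (s≤s j≤c) = subst₂ (Reach (left G c)) (m≤n⇒m⊓n≡m i≤c) (m≤n⇒m⊓n≡m j≤c)
      (Reach-map (_⊓ c) clamp (connected i j (≤-<-trans i≤c c<n) (≤-<-trans j≤c c<n)))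

  right-tree : IsTree (right G c)
  right-tree = (m<n⇒0<n∸m c<n , connected′) ,
    λ cycle → proj₂ tree (acyclic-⊑ {right G c} {G} (right-⊑ G c (<⇒≤ c<n)) cycle)
    where
    shift : ∀ {x y} → E G x y → x ∸ c ≡ y ∸ c ⊎ E (right G c) (x ∸ c) (y ∸ c)
    shift e with cut-side {G} uncrossed e
    ... | inj₁ (x≤c , y≤c) rewrite m≤n⇒m∸n≡0 x≤c | m≤n⇒m∸n≡0 y≤c = inj₁ refl
    ... | inj₂ (c≤x , c≤y) = inj₂ (subst₂ (E G) (sym (m∸n+n≡m c≤x)) (sym (m∸n+n≡m c≤y)) e)
    connected′ : ∀ i j → i < size G ∸ c → j < size G ∸ c → Reach (right G c) i j
    connected′ i j i<n∸c j<n∸c = subst₂ (Reach (right G c)) (m+n∸n≡m i c) (m+n∸n≡m j c)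
      (Reach-map (_∸ c) shift (connected (i + c) (j + c)
        (m≤o∸n⇒m+n≤o (suc i) (<⇒≤ c<n) i<n∸c) (m≤o∸n⇒m+n≤o (suc j) (<⇒≤ c<n) j<n∸c)))

  split : G ≅ (left G c ⊕ right G c)
  split = size≡ , λ i j → to i j , from i j
    where
    size≡ : size G ≡ suc c + (size G ∸ c) ∸ 1
    size≡ = sym (m+[n∸m]≡n (<⇒≤ c<n))
    to : ∀ i j → E G i j → E (left G c ⊕ right G c) i j
    to i j e with E-bound-≡ {G} size≡ e | cut-side {G} uncrossed e
    ... | i<s , j<s | inj₁ (i≤c , j≤c) = i<s , j<s , inj₁ (e , i≤c , j≤c)
    ... | i<s , j<s | inj₂ (c≤i , c≤j) =
      i<s , j<s , inj₂ (c≤i , c≤j , subst₂ (E G) (sym (m∸n+n≡m c≤i)) (sym (m∸n+n≡m c≤j)) e)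
    from : ∀ i j → E (left G c ⊕ right G c) i j → E G i j
    from i j (_ , _ , inj₁ (e , _)) = e
    from i j (_ , _ , inj₂ (c≤i , c≤j , e)) = subst₂ (E G) (m∸n+n≡m c≤i) (m∸n+n≡m c≤j) e

≅-refl : ∀ {G} → G ≅ G
≅-refl = refl , λ i j → (λ e → e) , (λ e → e)

≅-trans : ∀ {G H K} → G ≅ H → H ≅ K → G ≅ K
≅-trans (s , f) (s′ , g) = trans s s′ , λ i j →
  (λ e → proj₁ (g i j) (proj₁ (f i j) e)) , (λ e → proj₂ (f i j) (proj₂ (g i j) e))

⊕-cong : ∀ {G G′ H H′} → G ≅ G′ → H ≅ H′ → (G ⊕ H) ≅ (G′ ⊕ H′)
⊕-cong {G} {G′} {H} {H′} (sG , fG) (sH , fH) = size≡ , λ i j → to i j , from i j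
  where
  size≡ : size G + size H ∸ 1 ≡ size G′ + size H′ ∸ 1
  size≡ = cong₂ (λ a b → a + b ∸ 1) sG sH
  o≡ : size G ∸ 1 ≡ size G′ ∸ 1
  o≡ = cong (_∸ 1) sG
  to : ∀ i j → E (G ⊕ H) i j → E (G′ ⊕ H′) i j
  to i j (i< , j< , inj₁ e) = subst (i <_) size≡ i< , subst (j <_) size≡ j< , inj₁ (proj₁ (fG i j) e)
  to i j (i< , j< , inj₂ (o≤i , o≤j , e)) = subst (i <_) size≡ i< , subst (j <_) size≡ j< ,
    inj₂ (subst (_≤ i) o≡ o≤i , subst (_≤ j) o≡ o≤j ,
      subst₂ (E H′) (cong (i ∸_) o≡) (cong (j ∸_) o≡) (proj₁ (fH _ _) e))
  from : ∀ i j → E (G′ ⊕ H′) i j → E (G ⊕ H) i j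
  from i j (i< , j< , inj₁ e) =
    subst (i <_) (sym size≡) i< , subst (j <_) (sym size≡) j< , inj₁ (proj₂ (fG i j) e)
  from i j (i< , j< , inj₂ (o≤i , o≤j , e)) = subst (i <_) (sym size≡) i< , subst (j <_) (sym size≡) j< ,
    inj₂ (subst (_≤ i) (sym o≡) o≤i , subst (_≤ j) (sym o≡) o≤j ,
      proj₂ (fH _ _) (subst₂ (E H′) (cong (i ∸_) (sym o≡)) (cong (j ∸_) (sym o≡)) e))

replace-left : ∀ {G c S} → IsTree G → c < size G → ¬ Crossed G c → left G c ≅ S →
  G ≅ (S ⊕ right G c)
replace-left {G} {c} {S} tree c<n uncrossed left≅ =
  ≅-trans {G} {left G c ⊕ right G c} {S ⊕ right G c} (split tree c<n uncrossed)
    (⊕-cong {left G c} {S} {right G c} {right G c} left≅ (≅-refl {right G c}))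

-- Stars and the decomposition into stars

StarCentred : OGraph → ℕ → Set
StarCentred G c = (∀ {v} → v < size G → v ≢ c → E G v c) × (∀ {i j} → E G i j → i ≡ c ⊎ j ≡ c)

centred⇒≅star : ∀ {G} l r → size G ≡ l + r ∸ 1 → StarCentred G (l ∸ 1) → G ≅ star l r
centred⇒≅star {G} l r size≡ (spoke , touches) = size≡ , λ i j → to , from
  where
  to : ∀ {i j} → E G i j → E (star l r) i j
  to e with E-bound-≡ {G} size≡ e | touches e
  ... | i<s , j<s | inj₁ refl = i<s , j<s , inj₁ (refl , edge-≢ {G} e ∘ sym)
  ... | i<s , j<s | inj₂ refl = i<s , j<s , inj₂ (refl , edge-≢ {G} e)
  from : ∀ {i j} → E (star l r) i j → E G i j
  from (_ , j< , inj₁ (refl , j≢c)) = E-sym G (spoke (subst (_ <_) (sym size≡) j<) j≢c)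
  from (i< , _ , inj₂ (refl , i≢c)) = spoke (subst (_ <_) (sym size≡) i<) i≢c

hub⇒centred : ∀ {G} (Inner : ℕ → Set) {c o} → E G c o →
  (∀ {v} → v < size G → v ≡ c ⊎ v ≡ o ⊎ Inner v) →
  (∀ {v u} → Inner v → E G v u → u ≡ c ⊎ u ≡ o) →
  (∀ {v} → Inner v → E G v c → E G v o → ⊥) →
  (∀ {v} → Inner v → E G v c) → StarCentred G c
hub⇒centred {G} Inner {c} {o} c—o classify inner-neighbour not-both inner→c = spoke , touches
  where
  spoke : ∀ {v} → v < size G → v ≢ c → E G v c
  spoke v<n v≢c with classify v<n
  ... | inj₁ v≡c = ⊥-elim (v≢c v≡c)
  ... | inj₂ (inj₁ refl) = E-sym G c—o
  ... | inj₂ (inj₂ inner) = inner→c inner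
  touches : ∀ {i j} → E G i j → i ≡ c ⊎ j ≡ c
  touches e with classify (proj₁ (E-bound G e))
  ... | inj₁ i≡c = inj₁ i≡c
  ... | inj₂ (inj₂ inner) with inner-neighbour inner e
  ...   | inj₁ j≡c = inj₂ j≡c
  ...   | inj₂ refl = ⊥-elim (not-both inner (inner→c inner) e)
  touches e | inj₂ (inj₁ refl) with classify (proj₂ (E-bound G e))
  ... | inj₁ j≡c = inj₂ j≡c
  ... | inj₂ (inj₁ refl) = ⊥-elim (E-irr G e)
  ... | inj₂ (inj₂ inner) = ⊥-elim (not-both inner (inner→c inner) (E-sym G e))

module Uncrossed {G : OGraph} (tree : IsTree G) (untangled : Untangled G)
  (2≤n : 2 ≤ size G) (crossed : ∀ {c} → 0 < c → c < size G ∸ 1 → Crossed G c) where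

  open Untangled untangled

  private
    n m : ℕ
    n = size G
    m = size G ∸ 1

    m<n : m < n
    m<n = n∸1<n (<⇒≤ 2≤n)

    0<m : 0 < m
    0<m = m+n≤o⇒m≤o∸n 1 2≤n

    connected : ∀ i j → i < n → j < n → Reach G i j
    connected = proj₂ (proj₁ tree)

    E? : ∀ i j → Dec (E G i j)
    E? = tree-edge? tree

  Inner : ℕ → Set
  Inner v = 0 < v × v < m

  classify : ∀ {v} → v < n → v ≡ 0 ⊎ v ≡ m ⊎ Inner v
  classify {zero} _ = inj₁ refl
  classify {suc v} v<n with suc v ≟ m
  ... | yes v≡m = inj₂ (inj₁ v≡m)
  ... | no v≢m = inj₂ (inj₂ (s≤s z≤n , ≤∧≢⇒< (<⇒≤pred v<n) v≢m))

  0—m : E G 0 m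
  0—m with first-edge (<⇒≢ 0<m) (connected 0 m (<-trans 0<m m<n) m<n)
  ... | k , e₀ₖ with greatest-witness (E? 0) n (k , proj₂ (E-bound G e₀ₖ) , e₀ₖ)
  ...   | b , e₀b , beyond with m≤n⇒m<n∨m≡n (<⇒≤pred (proj₂ (E-bound G e₀b)))
  ...     | inj₂ refl = e₀b
  ...     | inj₁ b<m with crossed (n≢0⇒n>0 (≢-sym (edge-≢ {G} e₀b))) b<m
  ...       | i , i<b , j , j<n , b<j , eij with i ≟ 0
  ...         | yes refl = ⊥-elim (beyond b<j j<n eij)
  ...         | no i≢0 = ⊥-elim (unentangled e₀b eij
                  ( (≢-sym i≢0 , <⇒≢ (≤-<-trans z≤n (<-trans i<b b<j)) , ≢-sym (<⇒≢ i<b) , <⇒≢ b<j)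
                  , inj₁ (inj₁ (n≢0⇒n>0 i≢0 , i<b))))

  inner-neighbour : ∀ {v u} → Inner v → E G v u → u ≡ 0 ⊎ u ≡ m
  inner-neighbour {v} {u} (0<v , v<m) evu with u ≟ 0 | u ≟ m
  ... | yes u≡0 | _ = inj₁ u≡0
  ... | no _ | yes u≡m = inj₂ u≡m
  ... | no u≢0 | no u≢m = ⊥-elim (unentangled 0—m evu
        ((<⇒≢ 0<v , ≢-sym u≢0 , ≢-sym (<⇒≢ v<m) , ≢-sym u≢m) , inj₁ (inj₁ (0<v , v<m))))

  inner-attached : ∀ {v} → Inner v → E G v 0 ⊎ E G v m
  inner-attached {v} inner@(0<v , v<m)
    with first-edge (≢-sym (<⇒≢ 0<v)) (connected v 0 (<-trans v<m m<n) (<-trans 0<m m<n))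
  ... | k , evk with inner-neighbour inner evk
  ...   | inj₁ refl = inj₁ evk
  ...   | inj₂ refl = inj₂ evk

  not-both : ∀ {v} → Inner v → E G v 0 → E G v m → ⊥
  not-both _ ev0 evm = proj₂ tree (triangle⇒cycle {G} (E-sym G ev0) evm (E-sym G 0—m) (<⇒≢ 0<m))

  same-side : ∀ {v w} → Inner v → Inner w → E G v 0 → E G w m → ⊥
  same-side {v} {w} inner@(0<v , v<m) (0<w , w<m) ev0 ewm with <-cmp v w
  ... | tri< v<w _ _ = no-zigzag 0<v v<w w<m (E-sym G ev0) 0—m ewm
  ... | tri≈ _ refl _ = not-both inner ev0 ewm
  ... | tri> _ _ w<v = unentangled (E-sym G ev0) ewm
        ((<⇒≢ 0<w , <⇒≢ 0<m , ≢-sym (<⇒≢ w<v) , <⇒≢ v<m) , inj₁ (inj₁ (0<w , w<v)))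

  uncrossed⇒star : G ≅ star 1 n ⊎ G ≅ star n 1
  uncrossed⇒star with anyUpTo? (λ v → (0 <? v) ×-dec ¬? (E? v 0)) m
  ... | no none = inj₁ (centred⇒≅star {G} 1 n refl
        (hub⇒centred {G} Inner 0—m classify inner-neighbour not-both inner→0))
    where
    inner→0 : ∀ {v} → Inner v → E G v 0
    inner→0 {v} (0<v , v<m) with E? v 0
    ... | yes ev0 = ev0
    ... | no ¬ev0 = ⊥-elim (none (v , v<m , 0<v , ¬ev0))
  ... | yes (w , w<m , 0<w , ¬ew0) = inj₂ (centred⇒≅star {G} n 1 (sym (m+n∸n≡m n 1))
        (hub⇒centred {G} Inner (E-sym G 0—m) classify′ inner-neighbour′
          (λ inner evm ev0 → not-both inner ev0 evm) inner→m))
    where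
    classify′ : ∀ {v} → v < n → v ≡ m ⊎ v ≡ 0 ⊎ Inner v
    classify′ v<n with classify v<n
    ... | inj₁ v≡0 = inj₂ (inj₁ v≡0)
    ... | inj₂ (inj₁ v≡m) = inj₁ v≡m
    ... | inj₂ (inj₂ inner) = inj₂ (inj₂ inner)
    inner-neighbour′ : ∀ {v u} → Inner v → E G v u → u ≡ m ⊎ u ≡ 0
    inner-neighbour′ inner evu with inner-neighbour inner evu
    ... | inj₁ u≡0 = inj₂ u≡0
    ... | inj₂ u≡m = inj₁ u≡m
    ewm : E G w m
    ewm with inner-attached (0<w , w<m)
    ... | inj₁ ew0 = ⊥-elim (¬ew0 ew0)
    ... | inj₂ ewm = ewm
    inner→m : ∀ {v} → Inner v → E G v m
    inner→m inner with inner-attached inner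
    ... | inj₁ ev0 = ⊥-elim (same-side inner (0<w , w<m) ev0 ewm)
    ... | inj₂ evm = evm

prepend-star : ∀ {G H l r} → Admissible (l , r) → G ≅ (star l r ⊕ H) →
  IsMonotoneCaterpillar H → IsMonotoneCaterpillar G
prepend-star {G} {H} {l} {r} admissible G≅ (q , qs , admissible-q , admissible-qs , H≅) =
  (l , r) , q ∷ qs , admissible , admissible-q ∷ admissible-qs ,
  ≅-trans {G} {star l r ⊕ H} {star l r ⊕ chain q qs} G≅
    (⊕-cong {star l r} {star l r} {H} {chain q qs} (≅-refl {star l r}) H≅)

single-vertex⇒caterpillar : ∀ {G} → size G ≡ 1 → IsMonotoneCaterpillar G
single-vertex⇒caterpillar {G} size≡1 =
  (1 , 1) , [] , (≤-refl , ≤-refl , inj₁ refl) , [] , centred⇒≅star {G} 1 1 size≡1 (spoke , touches)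
  where
  spoke : ∀ {v} → v < size G → v ≢ 0 → E G v 0
  spoke v<n v≢0 = ⊥-elim (v≢0 (n<1⇒n≡0 (subst (_ <_) size≡1 v<n)))
  touches : ∀ {i j} → E G i j → i ≡ 0 ⊎ j ≡ 0
  touches e = inj₁ (n<1⇒n≡0 (subst (_ <_) size≡1 (proj₁ (E-bound G e))))

first-uncrossed : ∀ {G} → (∀ i j → Dec (E G i j)) → 2 ≤ size G →
  ∃ λ c → 0 < c × c < size G × ¬ Crossed G c × (∀ {c′} → 0 < c′ → c′ < c → Crossed G c′)
first-uncrossed {G} E? 2≤n
  with least-witness (λ c → (0 <? c) ×-dec ¬? (Crossed? {G} E? c)) m
         (m , ≤-refl , 0<m , last-uncrossed)
  where
  m : ℕ
  m = size G ∸ 1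
  0<m : 0 < m
  0<m = m+n≤o⇒m≤o∸n 1 2≤n
  last-uncrossed : ¬ Crossed G m
  last-uncrossed (_ , _ , j , j<n , m<j , _) = <⇒≱ m<j (<⇒≤pred j<n)
... | c , c≤m , (0<c , uncrossed) , below =
  c , 0<c , ≤-<-trans c≤m (n∸1<n (<⇒≤ 2≤n)) , uncrossed , crossed-below
  where
  crossed-below : ∀ {c′} → 0 < c′ → c′ < c → Crossed G c′
  crossed-below {c′} 0<c′ c′<c with Crossed? {G} E? c′
  ... | yes crossed = crossed
  ... | no ¬crossed = ⊥-elim (below c′<c (0<c′ , ¬crossed))

left-crossed : ∀ {G c c′} → ¬ Crossed G c → c′ < c → Crossed G c′ → Crossed (left G c) c′
left-crossed {c = c} uncrossed c′<c (i , i<c′ , j , j<n , c′<j , eij) with j ≤? c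
... | yes j≤c = i , i<c′ , j , s≤s j≤c , c′<j , eij , <⇒≤ (<-trans i<c′ c′<c) , j≤c
... | no j≰c = ⊥-elim (uncrossed (i , <-trans i<c′ c′<c , j , j<n , ≰⇒> j≰c , eij))

star⊕caterpillar : ∀ {G c} → IsTree G → c < size G → ¬ Crossed G c →
  left G c ≅ star 1 (suc c) ⊎ left G c ≅ star (suc c) 1 → IsMonotoneCaterpillar (right G c) →
  IsMonotoneCaterpillar G
star⊕caterpillar {G} {c} tree c<n uncrossed (inj₁ left≅) =
  prepend-star {G} {right G c} (≤-refl , s≤s z≤n , inj₁ refl)
    (replace-left {G} {c} {star 1 (suc c)} tree c<n uncrossed left≅)
star⊕caterpillar {G} {c} tree c<n uncrossed (inj₂ left≅) =
  prepend-star {G} {right G c} (s≤s z≤n , ≤-refl , inj₂ refl)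
    (replace-left {G} {c} {star (suc c) 1} tree c<n uncrossed left≅)

untangled-tree⇒caterpillar : ∀ {G} → IsTree G → Untangled G → IsMonotoneCaterpillar G
untangled-tree⇒caterpillar {G₀} = <-rec Goal build (size G₀) G₀ refl
  where
  Goal : ℕ → Set₁
  Goal n = ∀ G → size G ≡ n → IsTree G → Untangled G → IsMonotoneCaterpillar G
  build : ∀ n → (∀ {n′} → n′ < n → Goal n′) → Goal n
  build n smaller G refl tree untangled with size G ≟ 1
  ... | yes size≡1 = single-vertex⇒caterpillar {G} size≡1
  ... | no size≢1
    with first-uncrossed {G} (tree-edge? tree) (≤∧≢⇒< (proj₁ (proj₁ tree)) (≢-sym size≢1))
  ...   | c , 0<c , c<n , uncrossed , crossed-below =
    star⊕caterpillar tree c<n uncrossed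
      (Uncrossed.uncrossed⇒star {left G c} (left-tree tree c<n uncrossed)
        (Untangled-⊑ {left G c} {G} (left-⊑ G c c<n) untangled) (s≤s 0<c)
        (λ 0<c′ c′<c → left-crossed {G} uncrossed c′<c (crossed-below 0<c′ c′<c)))
      (smaller (∸-monoʳ-< 0<c (<⇒≤ c<n)) (right G c) refl (right-tree tree c<n uncrossed)
        (Untangled-⊑ {right G c} {G} (right-⊑ G c (<⇒≤ c<n)) untangled))

corollary15 : (G : OGraph) → IsTree G →
    (IsMonotoneCaterpillar G →
      ∀ (T : OGraph) → IsTree T → size T ≡ 4 → ¬ IsMonotoneCaterpillar T → ¬ (T ⊑ G))
    × ((∀ (T : OGraph) → IsTree T → size T ≡ 4 → ¬ IsMonotoneCaterpillar T → ¬ (T ⊑ G))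
      → IsMonotoneCaterpillar G)
corollary15 G tree =
  (λ caterpillar T T-tree _ T-not-caterpillar T⊑G →
     T-not-caterpillar (untangled-tree⇒caterpillar T-tree
       (Untangled-⊑ {T} {G} T⊑G (caterpillar⇒untangled {G} caterpillar)))) ,
  λ free → untangled-tree⇒caterpillar tree (obstruction-free⇒untangled tree free)
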